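{- Let $k \geq 1$ and $\overline{\Delta} \geq 0$ be integers. (1) For any integer $n \geq 4k+\overline{\Delta}+3$, there is a strongly $k$-connected $n$-vertex oriented graph $G$ with $\overline{\Delta}(G) \leq \overline{\Delta}$ and $\delta^+(G),\delta^-(G) \geq \lfloor \frac{n-\overline{\Delta}}{4} \rfloor - 1$, such that every spanning subgraph $D$ of $G$ with $\delta^+(D),\delta^-(D) \geq k$ contains at least $kn + k\overline{\Delta}$ edges. (2) For any integer $n \geq 5k+2$, there is a strongly $k$-connected $n$-vertex tournament $T$ with $\delta^+(T),\delta^-(T) \geq \lfloor \frac{n-k-3}{4} \rfloor$, such that every spanning subgraph $D$ of $T$ with $\delta^+(D),\delta^-(D) \geq k$ contains at least $kn + \frac{k(k-1)}{2}$ edges.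
   Context: An oriented graph is a digraph obtained from a simple undirected graph by orienting each edge; a tournament is an oriented orientation of a complete graph. $\overline{\Delta}(G)$ is the maximum over $v$ of the number of vertices $w\neq v$ with neither $(v,w)$ nor $(w,v)$ an edge. $\delta^+,\delta^-$ denote minimum out-degree and minimum in-degree. A digraph $D$ is strongly $k$-connected if $|V(D)|\geq k+1$ and $D-S$ is strongly connected for every vertex set $S$ with $|S|\leq k-1$. -}

module Defs where

open import Data.Nat using (ℕ; zero; suc; _+_; _*_; _∸_; _≤_)
open import Data.Nat.DivMod using (_/_)
open import Data.Bool using (Bool; true; false; not; _∧_; if_then_else_)
open import Data.Fin using (Fin; zero; suc; _≟_)
open import Data.Product using (_×_; Σ)
open import Data.Sum using (_⊎_)
open import Relation.Nullary using (¬_)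
open import Relation.Nullary.Decidable using (⌊_⌋)
open import Relation.Binary.PropositionalEquality using (_≡_)

count : {n : ℕ} → (Fin n → Bool) → ℕ
count {zero} P = 0
count {suc n} P = (if P zero then 1 else 0) + count (λ i → P (suc i))

Digraph : ℕ → Set
Digraph n = Fin n → Fin n → Bool

Oriented : {n : ℕ} → Digraph n → Set
Oriented {n} D = ((v : Fin n) → D v v ≡ false)
               × ((u v : Fin n) → D u v ≡ true → D v u ≡ false)

Tournament : {n : ℕ} → Digraph n → Set
Tournament {n} D = Oriented D
                 × ((u v : Fin n) → ¬ (u ≡ v) → (D u v ≡ true) ⊎ (D v u ≡ true))

outdeg : {n : ℕ} → Digraph n → Fin n → ℕ
outdeg D v = count (λ w → D v w)

indeg : {n : ℕ} → Digraph n → Fin n → ℕ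
indeg D v = count (λ w → D w v)

MinDegsAtLeast : {n : ℕ} → Digraph n → ℕ → Set
MinDegsAtLeast {n} D m = ((v : Fin n) → m ≤ outdeg D v) × ((v : Fin n) → m ≤ indeg D v)

nonNeighbours : {n : ℕ} → Digraph n → Fin n → ℕ
nonNeighbours D v = count (λ w → not ⌊ v ≟ w ⌋ ∧ not (D v w) ∧ not (D w v))

MaxNonDegAtMost : {n : ℕ} → Digraph n → ℕ → Set
MaxNonDegAtMost {n} D d = (v : Fin n) → nonNeighbours D v ≤ d

sumFin : {n : ℕ} → (Fin n → ℕ) → ℕ
sumFin {zero} f = 0
sumFin {suc n} f = f zero + sumFin (λ i → f (suc i))

edgeCount : {n : ℕ} → Digraph n → ℕ
edgeCount D = sumFin (outdeg D)

Spanning : {n : ℕ} → Digraph n → Digraph n → Set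
Spanning {n} D G = (u v : Fin n) → D u v ≡ true → G u v ≡ true

data Reach {n : ℕ} (D : Digraph n) (S : Fin n → Bool) : Fin n → Fin n → Set where
  here : ∀ {u} → Reach D S u u
  step : ∀ {u w v} → D u w ≡ true → S w ≡ false → Reach D S w v → Reach D S u v

StronglyConnectedWithout : {n : ℕ} → Digraph n → (Fin n → Bool) → Set
StronglyConnectedWithout {n} D S =
  (u v : Fin n) → S u ≡ false → S v ≡ false → Reach D S u v

StronglyKConnected : {n : ℕ} → ℕ → Digraph n → Set
StronglyKConnected {n} k D =
  (k + 1 ≤ n) × ((S : Fin n → Bool) → count S ≤ k ∸ 1 → StronglyConnectedWithout D S)

-- The graph has blocks A = [0, 2c+1), M of size r, and B: circulant tournaments on A and on B, all arcs
-- A → M → B, and all arcs A → B except a k-matching pointing back from B to A; M is independent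
-- (r = Δ̄ + 1) or a transitive tournament (r = k). The circulants give all degrees ≥ c ≈ (n − Δ̄)/4.
-- Deleting fewer than k ≤ c vertices leaves both circulants strongly connected and keeps a matching
-- arc with both ends, through which every vertex reaches every other. For a spanning D with δ± ≥ k,
-- the out-degrees over M ∪ B and the in-degrees over A ∪ M add up to (n + r)k, and an arc is counted
-- twice only if it runs from M ∪ B to A ∪ M, i.e. is a matching arc or lies inside M. Hence
-- e(D) ≥ (n + r)k − k − e(M), which is kn + kΔ̄, respectively at least kn + k(k − 1)/2.
module Submission where

open import Defs
open import Data.Bool using (Bool; true; false; not; _∧_; _∨_; if_then_else_)
open import Data.Bool.Properties using (¬-not; ∨-conicalˡ; ∨-conicalʳ)
import Data.Bool.Properties as Bool
open import Data.Fin as Fin using (Fin; toℕ; fromℕ<)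
open import Data.Fin.Properties using (toℕ-fromℕ<; fromℕ<-toℕ; toℕ-injective; toℕ<n; ¬∀⟶∃¬)
open import Data.Nat using (ℕ; zero; suc; _+_; _*_; _∸_; _≤_; _<_; z≤n; s≤s; _<?_; _≤?_; _≟_)
open import Data.Nat.DivMod using (_/_; m/n*n≤m; m*n/n≡m; /-monoˡ-≤; m/n≡1+[m∸n]/n)
open import Data.Nat.Properties
open import Data.Nat.Tactic.RingSolver using (solve-∀)
open import Algebra.Properties.CommutativeSemigroup +-commutativeSemigroup using (interchange)
open import Data.Product using (Σ; ∃; _×_; _,_; proj₁; proj₂)
open import Data.Sum using (_⊎_; inj₁; inj₂)
open import Function using (_∘_)
open import Relation.Binary.PropositionalEquality
open import Relation.Binary.Definitions using (tri<; tri≈; tri>)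
open import Relation.Nullary using (Dec; does; yes; no; ¬_; contradiction; _×-dec_)
open import Relation.Nullary.Decidable using (⌊_⌋; dec-true; dec-false; isYes≗does)

∧-trueˡ : ∀ {a b} → a ∧ b ≡ true → a ≡ true
∧-trueˡ {true} _ = refl

∧-trueʳ : ∀ {a b} → a ∧ b ≡ true → b ≡ true
∧-trueʳ {true} b≡true = b≡true

∧-true : ∀ {a b} → a ≡ true → b ≡ true → a ∧ b ≡ true
∧-true refl b≡true = b≡true

∨-introˡ : ∀ {a b} → a ≡ true → a ∨ b ≡ true
∨-introˡ refl = refl

∨-introʳ : ∀ {a b} → b ≡ true → a ∨ b ≡ true
∨-introʳ {a} refl = Bool.∨-zeroʳ a

not-true : ∀ {b} → not b ≡ true → b ≡ false
not-true {false} _ = refl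

does⇒ : ∀ {p} {P : Set p} (P? : Dec P) → does P? ≡ true → P
does⇒ (yes p) _ = p

¬does⇒ : ∀ {p} {P : Set p} (P? : Dec P) → does P? ≡ false → ¬ P
¬does⇒ (no ¬p) _ = ¬p

<⇒≤∸1 : ∀ {m n} → m < n → m ≤ n ∸ 1
<⇒≤∸1 (s≤s m≤n) = m≤n

⌊⌋-false⇒ : ∀ {p} {P : Set p} (P? : Dec P) → ⌊ P? ⌋ ≡ false → ¬ P
⌊⌋-false⇒ P? isNo = ¬does⇒ P? (trans (sym (isYes≗does P?)) isNo)

⌊⌋-true : ∀ {p} {P : Set p} (P? : Dec P) → P → ⌊ P? ⌋ ≡ true
⌊⌋-true P? p = trans (isYes≗does P?) (dec-true P? p)

bit : Bool → ℕ
bit b = if b then 1 else 0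

bit≤1 : ∀ b → bit b ≤ 1
bit≤1 true = ≤-refl
bit≤1 false = z≤n

bit-mono : ∀ {a b} → (a ≡ true → b ≡ true) → bit a ≤ bit b
bit-mono {false} _ = z≤n
bit-mono {true} a⇒b rewrite a⇒b refl = ≤-refl

bit-*-≤ : ∀ b {m} → bit b * m ≤ m
bit-*-≤ false = z≤n
bit-*-≤ true {m} = ≤-reflexive (+-identityʳ m)

bit-∨ : ∀ a b → bit (a ∨ b) ≤ bit a + bit b
bit-∨ true b = s≤s z≤n
bit-∨ false b = ≤-refl

sumFin-cong : ∀ {n} {f g : Fin n → ℕ} → (∀ i → f i ≡ g i) → sumFin f ≡ sumFin g
sumFin-cong {zero} eq = refl
sumFin-cong {suc n} eq = cong₂ _+_ (eq Fin.zero) (sumFin-cong (λ i → eq (Fin.suc i)))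

sumFin-mono : ∀ {n} {f g : Fin n → ℕ} → (∀ i → f i ≤ g i) → sumFin f ≤ sumFin g
sumFin-mono {zero} le = z≤n
sumFin-mono {suc n} le = +-mono-≤ (le Fin.zero) (sumFin-mono (λ i → le (Fin.suc i)))

sumFin-+ : ∀ {n} (f g : Fin n → ℕ) → sumFin (λ i → f i + g i) ≡ sumFin f + sumFin g
sumFin-+ {zero} f g = refl
sumFin-+ {suc n} f g =
  trans (cong (f Fin.zero + g Fin.zero +_) (sumFin-+ (λ i → f (Fin.suc i)) (λ i → g (Fin.suc i))))
        (interchange (f Fin.zero) (g Fin.zero) _ _)

sumFin-zero : ∀ n → sumFin {n} (λ _ → 0) ≡ 0
sumFin-zero zero = refl
sumFin-zero (suc n) = sumFin-zero n

sumFin-*ʳ : ∀ {n} (f : Fin n → ℕ) k → sumFin (λ i → f i * k) ≡ sumFin f * k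
sumFin-*ʳ {zero} f k = refl
sumFin-*ʳ {suc n} f k =
  trans (cong (f Fin.zero * k +_) (sumFin-*ʳ (λ i → f (Fin.suc i)) k)) (sym (*-distribʳ-+ k (f Fin.zero) _))

sumFin-swap : ∀ {n m} (f : Fin n → Fin m → ℕ) →
  sumFin (λ i → sumFin (λ j → f i j)) ≡ sumFin (λ j → sumFin (λ i → f i j))
sumFin-swap {zero} {m} f = sym (sumFin-zero m)
sumFin-swap {suc n} f = trans (cong (sumFin (f Fin.zero) +_) (sumFin-swap (λ i → f (Fin.suc i))))
  (sym (sumFin-+ (f Fin.zero) _))

count≡sumFin-bit : ∀ {n} (P : Fin n → Bool) → count P ≡ sumFin (λ i → bit (P i))
count≡sumFin-bit {zero} P = refl
count≡sumFin-bit {suc n} P = cong (bit (P Fin.zero) +_) (count≡sumFin-bit (λ i → P (Fin.suc i)))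

sumFin-+-mono : ∀ {n} {f₁ f₂ f₃ f₄ : Fin n → ℕ} → (∀ i → f₁ i + f₂ i ≤ f₃ i + f₄ i) →
  sumFin f₁ + sumFin f₂ ≤ sumFin f₃ + sumFin f₄
sumFin-+-mono {n} {f₁} {f₂} {f₃} {f₄} le = begin
  sumFin f₁ + sumFin f₂             ≡⟨ sumFin-+ f₁ f₂ ⟨
  sumFin (λ i → f₁ i + f₂ i)        ≤⟨ sumFin-mono le ⟩
  sumFin (λ i → f₃ i + f₄ i)        ≡⟨ sumFin-+ f₃ f₄ ⟩
  sumFin f₃ + sumFin f₄             ∎
  where open ≤-Reasoning

count-none : ∀ {n} {P : Fin n → Bool} → (∀ i → P i ≡ false) → count P ≡ 0
count-none {zero} _ = refl
count-none {suc n} none rewrite none Fin.zero = count-none (λ i → none (Fin.suc i))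

count-≤ : ∀ {n} (P : Fin n → Bool) → count P ≤ n
count-≤ {zero} P = z≤n
count-≤ {suc n} P = +-mono-≤ (bit≤1 (P Fin.zero)) (count-≤ (λ i → P (Fin.suc i)))

count-all : ∀ {n} {P : Fin n → Bool} → (∀ i → P i ≡ true) → count P ≡ n
count-all {zero} _ = refl
count-all {suc n} all rewrite all Fin.zero = cong suc (count-all (λ i → all (Fin.suc i)))

count-mono : ∀ {n} {P Q : Fin n → Bool} → (∀ i → P i ≡ true → Q i ≡ true) → count P ≤ count Q
count-mono {zero} _ = z≤n
count-mono {suc n} P⇒Q = +-mono-≤ (bit-mono (P⇒Q Fin.zero)) (count-mono (λ i → P⇒Q (Fin.suc i)))

count-∨ : ∀ {n} (P Q : Fin n → Bool) → count (λ i → P i ∨ Q i) ≤ count P + count Q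
count-∨ {zero} P Q = z≤n
count-∨ {suc n} P Q = ≤-trans
  (+-mono-≤ (bit-∨ (P Fin.zero) (Q Fin.zero)) (count-∨ (λ i → P (Fin.suc i)) (λ i → Q (Fin.suc i))))
  (≤-reflexive (interchange (bit (P Fin.zero)) (bit (Q Fin.zero)) _ _))

count-guard : ∀ {n} b (P : Fin n → Bool) {m} → (b ≡ true → count P ≤ m) →
  count (λ i → b ∧ P i) ≤ bit b * m
count-guard {n} false P _ = ≤-reflexive (count-none {n} (λ _ → refl))
count-guard true P {m} bound = subst (_ ≤_) (sym (+-identityʳ m)) (bound refl)

count-<-remove : ∀ {n} {P Q : Fin n → Bool} i → P i ≡ true → Q i ≡ false →
  (∀ j → Q j ≡ true → P j ≡ true) → count Q < count P
count-<-remove {suc n} {P} {Q} Fin.zero Pi Qi Q⇒P rewrite Pi | Qi =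
  s≤s (count-mono (λ j → Q⇒P (Fin.suc j)))
count-<-remove {suc n} {P} {Q} (Fin.suc i) Pi Qi Q⇒P = begin-strict
  bit (Q Fin.zero) + count (λ j → Q (Fin.suc j))
    <⟨ +-monoʳ-< (bit (Q Fin.zero)) (count-<-remove i Pi Qi (λ j → Q⇒P (Fin.suc j))) ⟩
  bit (Q Fin.zero) + count (λ j → P (Fin.suc j))
    ≤⟨ +-monoˡ-≤ _ (bit-mono (Q⇒P Fin.zero)) ⟩
  bit (P Fin.zero) + count (λ j → P (Fin.suc j))   ∎
  where open ≤-Reasoning

count-others : ∀ {n} (P : Fin n → Bool) {u} → P u ≡ true →
  count (λ v → P v ∧ not ⌊ u Fin.≟ v ⌋) ≤ count P ∸ 1
count-others P {u} Pu = <⇒≤∸1 (count-<-remove u Pu u≠u (λ v → ∧-trueˡ))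
  where
  u≠u : P u ∧ not ⌊ u Fin.≟ u ⌋ ≡ false
  u≠u rewrite ⌊⌋-true (u Fin.≟ u) refl = Bool.∧-zeroʳ (P u)

countTo : ℕ → (ℕ → Bool) → ℕ
countTo n f = count {n} (λ i → f (toℕ i))

countTo-split : ∀ a b (f : ℕ → Bool) → countTo (a + b) f ≡ countTo a f + countTo b (λ i → f (a + i))
countTo-split zero b f = refl
countTo-split (suc a) b f =
  trans (cong (bit (f 0) +_) (countTo-split a b (λ i → f (suc i)))) (sym (+-assoc (bit (f 0)) _ _))

countTo-window : ∀ {a L n} (f : ℕ → Bool) → a + L ≤ n → countTo L (λ t → f (a + t)) ≤ countTo n f
countTo-window {a} {L} {n} f a+L≤n = begin
  countTo L (λ t → f (a + t))
    ≤⟨ m≤n+m _ _ ⟩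
  countTo a f + countTo L (λ t → f (a + t))
    ≡⟨ countTo-split a L f ⟨
  countTo (a + L) f
    ≤⟨ m≤m+n _ _ ⟩
  countTo (a + L) f + countTo (n ∸ (a + L)) (λ t → f (a + L + t))
    ≡⟨ countTo-split (a + L) _ f ⟨
  countTo (a + L + (n ∸ (a + L))) f
    ≡⟨ cong (λ m → countTo m f) (m+[n∸m]≡n a+L≤n) ⟩
  countTo n f ∎
  where open ≤-Reasoning

countTo-windows : ∀ {a A b B n} (f : ℕ → Bool) → a + A ≤ b → b + B ≤ n →
  countTo A (λ t → f (a + t)) + countTo B (λ t → f (b + t)) ≤ countTo n f
countTo-windows {a} {A} {b} {B} {n} f a+A≤b b+B≤n = begin
  countTo A (λ t → f (a + t)) + countTo B (λ t → f (b + t))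
    ≤⟨ +-monoˡ-≤ _ (countTo-window {a} {A} f a+A≤b) ⟩
  countTo b f + countTo B (λ t → f (b + t))
    ≡⟨ countTo-split b B f ⟨
  countTo (b + B) f
    ≤⟨ countTo-window {0} f b+B≤n ⟩
  countTo n f ∎
  where open ≤-Reasoning

countTo-all : ∀ {L} {f : ℕ → Bool} → (∀ t → t < L → f t ≡ true) → countTo L f ≡ L
countTo-all all = count-all (λ i → all (toℕ i) (toℕ<n i))

countTo-intervals : ∀ {a A b B n} (f : ℕ → Bool) → a + A ≤ b → b + B ≤ n →
  (∀ t → t < A → f (a + t) ≡ true) → (∀ t → t < B → f (b + t) ≡ true) → A + B ≤ countTo n f
countTo-intervals {a} {A} {b} {B} f a+A≤b b+B≤n inA inB =
  subst₂ (λ x y → x + y ≤ _) (countTo-all inA) (countTo-all inB) (countTo-windows {a} {A} {b} {B} f a+A≤b b+B≤n)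

countTo-interval : ∀ {a L n} (f : ℕ → Bool) → a + L ≤ n → (∀ t → t < L → f (a + t) ≡ true) →
  L ≤ countTo n f
countTo-interval {a} {L} f a+L≤n inL = countTo-intervals {0} {0} {a} {L} f z≤n a+L≤n (λ _ ()) inL

countTo-support : ∀ {a L} n (f : ℕ → Bool) → (∀ i → f i ≡ true → a ≤ i × i < a + L) → countTo n f ≤ L
countTo-support {a} {L} n f supp = begin
  countTo n f
    ≤⟨ countTo-window {0} f (m≤n+m n (a + L)) ⟩
  countTo (a + L + n) f
    ≡⟨ countTo-split (a + L) n f ⟩
  countTo (a + L) f + countTo n (λ t → f (a + L + t))
    ≡⟨ cong (countTo (a + L) f +_) (count-none {n} (λ i → after (toℕ i))) ⟩
  countTo (a + L) f + 0
    ≡⟨ +-identityʳ _ ⟩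
  countTo (a + L) f
    ≡⟨ countTo-split a L f ⟩
  countTo a f + countTo L (λ t → f (a + t))
    ≡⟨ cong (_+ countTo L (λ t → f (a + t))) (count-none {a} (λ i → before (toℕ i) (toℕ<n i))) ⟩
  countTo L (λ t → f (a + t))
    ≤⟨ count-≤ _ ⟩
  L ∎
  where
  open ≤-Reasoning
  before : ∀ t → t < a → f t ≡ false
  before t t<a = ¬-not (λ ft → <⇒≱ t<a (proj₁ (supp t ft)))
  after : ∀ t → f (a + L + t) ≡ false
  after t = ¬-not (λ ft → m+n≮m (a + L) t (proj₂ (supp _ ft)))

-- Pair counts and the degree-sum bound

pairs : ∀ {n} → (Fin n → Fin n → Bool) → ℕ
pairs R = sumFin (λ u → count (R u))

pairs-transpose : ∀ {n} (R : Fin n → Fin n → Bool) → pairs R ≡ pairs (λ u v → R v u)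
pairs-transpose R = begin
  sumFin (λ u → count (R u))                 ≡⟨ sumFin-cong (λ u → count≡sumFin-bit (R u)) ⟩
  sumFin (λ u → sumFin (λ v → bit (R u v)))  ≡⟨ sumFin-swap (λ u v → bit (R u v)) ⟩
  sumFin (λ v → sumFin (λ u → bit (R u v)))  ≡⟨ sumFin-cong (λ v → count≡sumFin-bit (λ u → R u v)) ⟨
  sumFin (λ v → count (λ u → R u v))         ∎
  where open ≡-Reasoning

pairs-∨ : ∀ {n} (R R′ : Fin n → Fin n → Bool) → pairs (λ u v → R u v ∨ R′ u v) ≤ pairs R + pairs R′
pairs-∨ R R′ = ≤-trans (sumFin-mono (λ u → count-∨ (R u) (R′ u)))
                       (≤-reflexive (sumFin-+ (λ u → count (R u)) (λ u → count (R′ u))))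

pairs-+-mono : ∀ {n} {R₁ R₂ R₃ R₄ : Fin n → Fin n → Bool} →
  (∀ u v → bit (R₁ u v) + bit (R₂ u v) ≤ bit (R₃ u v) + bit (R₄ u v)) →
  pairs R₁ + pairs R₂ ≤ pairs R₃ + pairs R₄
pairs-+-mono {R₁ = R₁} {R₂} {R₃} {R₄} le = sumFin-+-mono λ u →
  subst₂ _≤_ (sym (cong₂ _+_ (count≡sumFin-bit (R₁ u)) (count≡sumFin-bit (R₂ u))))
             (sym (cong₂ _+_ (count≡sumFin-bit (R₃ u)) (count≡sumFin-bit (R₄ u))))
             (sumFin-+-mono (le u))

pairs-rows : ∀ {n} (P : Fin n → Bool) (R : Fin n → Fin n → Bool) {k} →
  (∀ u → P u ≡ true → k ≤ count (R u)) → count P * k ≤ pairs (λ u v → P u ∧ R u v)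
pairs-rows P R {k} rowBound = begin
  count P * k                                ≡⟨ cong (_* k) (count≡sumFin-bit P) ⟩
  sumFin (λ u → bit (P u)) * k               ≡⟨ sumFin-*ʳ (λ u → bit (P u)) k ⟨
  sumFin (λ u → bit (P u) * k)               ≤⟨ sumFin-mono row ⟩
  pairs (λ u v → P u ∧ R u v)                ∎
  where
  open ≤-Reasoning
  row : ∀ u → bit (P u) * k ≤ count (λ v → P u ∧ R u v)
  row u with P u in Pu
  ... | false = z≤n
  ... | true = subst (_≤ _) (sym (+-identityʳ k)) (rowBound u Pu)

pairs-mono : ∀ {n} {R R′ : Fin n → Fin n → Bool} → (∀ u v → R u v ≡ true → R′ u v ≡ true) →
  pairs R ≤ pairs R′
pairs-mono R⇒R′ = sumFin-mono (λ u → count-mono (R⇒R′ u))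

bit-double-count : ∀ p q d g → (d ≡ true → g ≡ true) →
  bit (p ∧ d) + bit (q ∧ d) ≤ bit d + bit (p ∧ q ∧ g)
bit-double-count false false d g _ = z≤n
bit-double-count false true d g _ = m≤m+n (bit d) 0
bit-double-count true false d g _ = ≤-refl
bit-double-count true true false g _ = z≤n
bit-double-count true true true g d⇒g rewrite d⇒g refl = ≤-refl

-- Counting out-arcs at P and in-arcs at Q counts an arc twice only if it runs from P to Q.
edgeCount-≥ : ∀ {n k} (P Q : Fin n → Bool) {G D : Digraph n} → Spanning D G → MinDegsAtLeast D k →
  count P * k + count Q * k ≤ edgeCount D + pairs (λ u v → P u ∧ Q v ∧ G u v)
edgeCount-≥ {k = k} P Q {G} {D} D⊆G (δ⁺ , δ⁻) = begin
  count P * k + count Q * k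
    ≤⟨ +-mono-≤ (pairs-rows P D (λ u _ → δ⁺ u)) (pairs-rows Q (λ v u → D u v) (λ v _ → δ⁻ v)) ⟩
  pairs (λ u v → P u ∧ D u v) + pairs (λ v u → Q v ∧ D u v)
    ≡⟨ cong (pairs (λ u v → P u ∧ D u v) +_) (pairs-transpose (λ v u → Q v ∧ D u v)) ⟩
  pairs (λ u v → P u ∧ D u v) + pairs (λ u v → Q v ∧ D u v)
    ≤⟨ pairs-+-mono (λ u v → bit-double-count (P u) (Q v) (D u v) (G u v) (D⊆G u v)) ⟩
  edgeCount D + pairs (λ u v → P u ∧ Q v ∧ G u v) ∎
  where open ≤-Reasoning

pairs-none : ∀ n → pairs {n} (λ _ _ → false) ≡ 0
pairs-none n = trans (sumFin-cong {n} (λ u → count-none {n} (λ _ → refl))) (sumFin-zero n)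

arcsWithin : ∀ {n} → (Fin n → Bool) → Digraph n → ℕ
arcsWithin P G = pairs (λ u v → P u ∧ P v ∧ G u v)

arcsWithin-≤ : ∀ {n} (P : Fin n → Bool) {G : Digraph n} → Oriented G →
  arcsWithin P G + arcsWithin P G ≤ count P * (count P ∸ 1)
arcsWithin-≤ {n} P {G} (irrefl , antisym) = begin
  arcsWithin P G + arcsWithin P G
    ≡⟨ cong (arcsWithin P G +_) (pairs-transpose (λ u v → P u ∧ P v ∧ G u v)) ⟩
  arcsWithin P G + pairs (λ u v → P v ∧ P u ∧ G v u)
    ≤⟨ pairs-+-mono pointwise ⟩
  pairs (λ u v → P u ∧ (P v ∧ not ⌊ u Fin.≟ v ⌋)) + pairs {n} (λ _ _ → false)
    ≡⟨ cong (pairs (λ u v → P u ∧ (P v ∧ not ⌊ u Fin.≟ v ⌋)) +_) (pairs-none n) ⟩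
  pairs (λ u v → P u ∧ (P v ∧ not ⌊ u Fin.≟ v ⌋)) + 0
    ≤⟨ +-monoˡ-≤ 0 (sumFin-mono λ u →
         count-guard {n} (P u) (λ v → P v ∧ not ⌊ u Fin.≟ v ⌋) (count-others P)) ⟩
  sumFin (λ u → bit (P u) * (count P ∸ 1)) + 0
    ≡⟨ +-identityʳ _ ⟩
  sumFin (λ u → bit (P u) * (count P ∸ 1))
    ≡⟨ sumFin-*ʳ (λ u → bit (P u)) (count P ∸ 1) ⟩
  sumFin (λ u → bit (P u)) * (count P ∸ 1)
    ≡⟨ cong (_* (count P ∸ 1)) (count≡sumFin-bit P) ⟨
  count P * (count P ∸ 1) ∎
  where
  open ≤-Reasoning
  pointwise : ∀ u v →
    bit (P u ∧ P v ∧ G u v) + bit (P v ∧ P u ∧ G v u) ≤ bit (P u ∧ (P v ∧ not ⌊ u Fin.≟ v ⌋)) + 0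
  pointwise u v with P u | P v
  ... | false | false = z≤n
  ... | false | true = z≤n
  ... | true | false = z≤n
  ... | true | true with u Fin.≟ v
  ...   | yes refl rewrite irrefl u = z≤n
  ...   | no _ with G u v in uv
  ...     | true rewrite antisym u v uv = ≤-refl
  ...     | false = +-monoʳ-≤ 0 (bit≤1 (G v u))

-- Circulant tournaments

-- On an interval of length 2c+1 this is the rotational tournament i → i+1, …, i+c (mod 2c+1);
-- on a longer interval it is still a tournament, and every degree stays at least c.
circulant : ℕ → ℕ → ℕ → Bool
circulant c i j = if does (i <? j) then does (j ≤? i + c) else does (j + c <? i)

circulant-< : ∀ {c i j} → i < j → circulant c i j ≡ does (j ≤? i + c)
circulant-< {c} {i} {j} i<j rewrite dec-true (i <? j) i<j = refl

circulant-≮ : ∀ {c i j} → ¬ i < j → circulant c i j ≡ does (j + c <? i)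
circulant-≮ {c} {i} {j} i≮j rewrite dec-false (i <? j) i≮j = refl

circulant-forward : ∀ {c i j} → i < j → j ≤ i + c → circulant c i j ≡ true
circulant-forward {c} {i} {j} i<j j≤i+c = trans (circulant-< i<j) (dec-true (j ≤? i + c) j≤i+c)

circulant-backward : ∀ {c i j} → j + c < i → circulant c i j ≡ true
circulant-backward {c} {i} {j} j+c<i =
  trans (circulant-≮ (<⇒≯ (≤-<-trans (m≤m+n j c) j+c<i))) (dec-true (j + c <? i) j+c<i)

circulant-irrefl : ∀ c i → circulant c i i ≡ false
circulant-irrefl c i = trans (circulant-≮ {c} {i} (<-irrefl refl)) (dec-false (i + c <? i) (m+n≮m i c))

circulant-antisym : ∀ c i j → circulant c i j ≡ true → circulant c j i ≡ false
circulant-antisym c i j i→j with i <? j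
... | yes i<j = trans (circulant-≮ {c} (<⇒≯ i<j))
  (dec-false (i + c <? j) (≤⇒≯ (does⇒ (j ≤? i + c) (trans (sym (circulant-< {c} i<j)) i→j))))
... | no i≮j = trans (circulant-< {c} (≤-<-trans (m≤m+n j c) j+c<i)) (dec-false (i ≤? j + c) (<⇒≱ j+c<i))
  where
  j+c<i : j + c < i
  j+c<i = does⇒ (j + c <? i) (trans (sym (circulant-≮ {c} i≮j)) i→j)

circulant-total : ∀ c i j → i ≢ j → circulant c i j ≡ true ⊎ circulant c j i ≡ true
circulant-total c i j i≢j with <-cmp i j
... | tri≈ _ i≡j _ = contradiction i≡j i≢j
... | tri< i<j _ _ with j ≤? i + c
...   | yes j≤i+c = inj₁ (circulant-forward i<j j≤i+c)
...   | no j≰i+c = inj₂ (circulant-backward {c} (≰⇒> j≰i+c))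
circulant-total c i j i≢j | tri> _ _ j<i with i ≤? j + c
...   | yes i≤j+c = inj₂ (circulant-forward j<i i≤j+c)
...   | no i≰j+c = inj₁ (circulant-backward {c} (≰⇒> i≰j+c))

circulant-flip : ∀ {c i j} → i ≢ j → circulant c j i ≡ not (circulant c i j)
circulant-flip {c} {i} {j} i≢j with circulant-total c i j i≢j
... | inj₁ i→j = trans (circulant-antisym c i j i→j) (cong not (sym i→j))
... | inj₂ j→i = trans j→i (cong not (sym (circulant-antisym c j i j→i)))

circulant-outdegree : ∀ {c a s n x} (f : ℕ → Bool) → a + s ≤ n → suc (c + c) ≤ s → x < s →
  (∀ y → y < s → circulant c x y ≡ true → f (a + y) ≡ true) → c ≤ countTo n f
circulant-outdegree {c} {a} {s} {n} {x} f a+s≤n 2c<s x<s out with m≤n⇒∃[o]m+o≡n x<s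
... | B , refl with c ≤? B
...   | yes c≤B = countTo-interval {a + suc x} f bound ahead
  where
  bound : a + suc x + c ≤ n
  bound = ≤-trans (≤-reflexive (+-assoc a (suc x) c)) (≤-trans (+-monoʳ-≤ a (+-monoʳ-≤ (suc x) c≤B)) a+s≤n)
  ahead : ∀ t → t < c → f (a + suc x + t) ≡ true
  ahead t t<c = subst (λ z → f z ≡ true) (sym (+-assoc a (suc x) t))
    (out (suc x + t) (+-monoʳ-< (suc x) (<-≤-trans t<c c≤B))
      (circulant-forward (s≤s (m≤m+n x t)) (+-monoʳ-< x t<c)))
...   | no c≰B
  with m≤n⇒∃[o]m+o≡n (≮⇒≥ λ (x<c : x < c) → <⇒≱ (+-mono-< x<c (≰⇒> c≰B)) (≤-pred 2c<s))
...     | A , refl = ≤-trans (+-cancelˡ-≤ c c (A + B) c+c≤c+[A+B])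
    (countTo-intervals {a} {A} {a + suc x} f (+-monoʳ-≤ a (≤-trans (m≤n+m A c) (n≤1+n x))) bound behind ahead)
  where
  c+c≤c+[A+B] : c + c ≤ c + (A + B)
  c+c≤c+[A+B] = ≤-trans (≤-pred 2c<s) (≤-reflexive (+-assoc c A B))
  bound : a + suc x + B ≤ n
  bound = ≤-trans (≤-reflexive (+-assoc a (suc x) B)) a+s≤n
  behind : ∀ t → t < A → f (a + t) ≡ true
  behind t t<A = out t (<-trans (<-≤-trans t<A (m≤n+m A c)) (s≤s (m≤m+n x B)))
    (circulant-backward {c} (subst (t + c <_) (+-comm A c) (+-monoˡ-< c t<A)))
  ahead : ∀ t → t < B → f (a + suc x + t) ≡ true
  ahead t t<B = subst (λ z → f z ≡ true) (sym (+-assoc a (suc x) t))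
    (out (suc x + t) (+-monoʳ-< (suc x) t<B)
      (circulant-forward (s≤s (m≤m+n x t)) (+-monoʳ-< x (<-trans t<B (≰⇒> c≰B)))))

circulant-indegree : ∀ {c a s n x} (f : ℕ → Bool) → a + s ≤ n → suc (c + c) ≤ s → x < s →
  (∀ y → y < s → circulant c y x ≡ true → f (a + y) ≡ true) → c ≤ countTo n f
circulant-indegree {c} {a} {s} {n} {x} f a+s≤n 2c<s x<s into with c ≤? x
... | yes c≤x with m≤n⇒∃[o]m+o≡n c≤x
...   | A , refl = countTo-interval {a + A} f bound behind
  where
  bound : a + A + c ≤ n
  bound = ≤-trans (≤-reflexive (trans (+-assoc a A c) (cong (a +_) (+-comm A c))))
                  (≤-trans (+-monoʳ-≤ a (<⇒≤ x<s)) a+s≤n)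
  behind : ∀ t → t < c → f (a + A + t) ≡ true
  behind t t<c = subst (λ z → f z ≡ true) (sym (+-assoc a A t)) (into (A + t) (<-trans y<x x<s)
    (circulant-forward y<x (≤-trans (≤-reflexive (+-comm c A)) (+-monoˡ-≤ c (m≤m+n A t)))))
    where
    y<x : A + t < c + A
    y<x = subst (A + t <_) (+-comm A c) (+-monoʳ-< A t<c)
circulant-indegree {c} {a} {s} {n} {x} f a+s≤n 2c<s x<s into | no c≰x
  with m≤n⇒∃[o]m+o≡n (≤-trans (s≤s (+-monoˡ-≤ c (<⇒≤ (≰⇒> c≰x)))) 2c<s)
...   | B , refl = ≤-trans (+-cancelˡ-≤ c c (x + B) c+c≤c+[x+B])
    (countTo-intervals {a} {x} {a + suc (x + c)} f (+-monoʳ-≤ a (≤-trans (m≤m+n x c) (n≤1+n _))) bound behind ahead)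
  where
  c+c≤c+[x+B] : c + c ≤ c + (x + B)
  c+c≤c+[x+B] = ≤-trans (≤-pred 2c<s) (≤-reflexive (trans (cong (_+ B) (+-comm x c)) (+-assoc c x B)))
  bound : a + suc (x + c) + B ≤ n
  bound = ≤-trans (≤-reflexive (+-assoc a (suc (x + c)) B)) a+s≤n
  behind : ∀ t → t < x → f (a + t) ≡ true
  behind t t<x = into t (<-trans t<x x<s) (circulant-forward t<x (≤-trans (<⇒≤ (≰⇒> c≰x)) (m≤n+m c t)))
  ahead : ∀ t → t < B → f (a + suc (x + c) + t) ≡ true
  ahead t t<B = subst (λ z → f z ≡ true) (sym (+-assoc a (suc (x + c)) t))
    (into (suc (x + c) + t) (+-monoʳ-< (suc (x + c)) t<B) (circulant-backward {c} (s≤s (m≤m+n (x + c) t))))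

-- Walks avoiding deleted vertices

data Walk (n : ℕ) (E : ℕ → ℕ → Bool) (S : ℕ → Bool) : ℕ → ℕ → Set where
  here : ∀ {i} → Walk n E S i i
  step : ∀ {i j l} → j < n → E i j ≡ true → S j ≡ false → Walk n E S j l → Walk n E S i l

_++ᵂ_ : ∀ {n E S i j l} → Walk n E S i j → Walk n E S j l → Walk n E S i l
here ++ᵂ w = w
step j<n arc free w ++ᵂ w′ = step j<n arc free (w ++ᵂ w′)

extend : ∀ {n} → (Fin n → Bool) → ℕ → Bool
extend {n} S i with i <? n
... | yes i<n = S (fromℕ< i<n)
... | no _ = true

extend-toℕ : ∀ {n} (S : Fin n → Bool) u → extend S (toℕ u) ≡ S u
extend-toℕ {n} S u with toℕ u <? n
... | yes u<n = cong S (fromℕ<-toℕ u u<n)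
... | no u≮n = contradiction (toℕ<n u) u≮n

walk⇒reach : ∀ {n E} (S : Fin n → Bool) {i l} → Walk n E (extend S) i l →
  ∀ u v → toℕ u ≡ i → toℕ v ≡ l → Reach (λ u v → E (toℕ u) (toℕ v)) S u v
walk⇒reach S here u v refl v≡u = subst (Reach _ S u) (toℕ-injective (sym v≡u)) here
walk⇒reach {E = E} S (step j<n arc Sj w) u v refl v≡l = step
  (subst (λ z → E (toℕ u) z ≡ true) (sym (toℕ-fromℕ< j<n)) arc)
  (trans (sym (extend-toℕ S (fromℕ< j<n))) (subst (λ z → extend S z ≡ false) (sym (toℕ-fromℕ< j<n)) Sj))
  (walk⇒reach S w (fromℕ< j<n) v (toℕ-fromℕ< j<n) v≡l)

module AvoidingFew {n k} (S : ℕ → Bool) (few : countTo n S < k) where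

  free : ∀ a → a + k ≤ n → ∃ λ t → t < k × S (a + t) ≡ false
  free a a+k≤n with ¬∀⟶∃¬ k (λ i → S (a + toℕ i) ≡ true) (λ i → S (a + toℕ i) Bool.≟ true) notAll
    where
    notAll : ¬ (∀ i → S (a + toℕ i) ≡ true)
    notAll all = <⇒≱ few (subst (_≤ _) (count-all all) (countTo-window {a} {k} S a+k≤n))
  ... | i , Si≢true = toℕ i , toℕ<n i , ¬-not Si≢true

  freePair : ∀ a b → a + k ≤ b → b + k ≤ n → ∃ λ t → t < k × S (a + t) ≡ false × S (b + t) ≡ false
  freePair a b a+k≤b b+k≤n
    with ¬∀⟶∃¬ k (λ i → S (a + toℕ i) ∨ S (b + toℕ i) ≡ true) (λ i → _ Bool.≟ true) notAll
    where
    notAll : ¬ (∀ i → S (a + toℕ i) ∨ S (b + toℕ i) ≡ true)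
    notAll all = <⇒≱ few (begin
      k
        ≡⟨ count-all all ⟨
      countTo k (λ t → S (a + t) ∨ S (b + t))
        ≤⟨ count-∨ {k} (λ i → S (a + toℕ i)) (λ i → S (b + toℕ i)) ⟩
      countTo k (λ t → S (a + t)) + countTo k (λ t → S (b + t))
        ≤⟨ countTo-windows {a} {k} {b} {k} S a+k≤b b+k≤n ⟩
      countTo n S ∎)
      where open ≤-Reasoning
  ... | i , Si≢true = toℕ i , toℕ<n i , ∨-conicalˡ _ _ (¬-not Si≢true) , ∨-conicalʳ _ _ (¬-not Si≢true)

  module CirculantInterval (E : ℕ → ℕ → Bool) {c} (k≤c : k ≤ c) (a s : ℕ) (a+s≤n : a + s ≤ n)
    (2c<s : suc (c + c) ≤ s)
    (embeds : ∀ {x y} → x < s → y < s → circulant c x y ≡ true → E (a + x) (a + y) ≡ true) where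

    W : ℕ → ℕ → Set
    W = Walk n E S

    arc : ∀ {x y} → x < s → y < s → circulant c x y ≡ true → S (a + y) ≡ false → W (a + x) (a + y)
    arc x<s y<s x→y Sy = step (<-≤-trans (+-monoʳ-< a y<s) a+s≤n) (embeds x<s y<s x→y) Sy here

    -- Step to a surviving vertex among x + c − k + 1, …, x + c: fewer than k vertices are deleted.
    climb : ∀ m {x y} → y ≤ x + m → x < y → y < s → S (a + y) ≡ false → W (a + x) (a + y)
    climb zero {x} y≤x+0 x<y _ _ = contradiction (≤-trans y≤x+0 (≤-reflexive (+-identityʳ x))) (<⇒≱ x<y)
    climb (suc m) {x} {y} y≤x+m x<y y<s Sy with y ≤? x + c
    ... | yes y≤x+c = arc (<-trans x<y y<s) y<s (circulant-forward x<y y≤x+c) Sy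
    ... | no y≰x+c =
      viaFree (free (a + B) (≤-trans (≤-reflexive (+-assoc a B k)) (≤-trans (+-monoʳ-≤ a B+k≤y) a+y≤n)))
      where
      B = suc x + (c ∸ k)
      B+k≡1+x+c : B + k ≡ suc x + c
      B+k≡1+x+c = trans (+-assoc (suc x) (c ∸ k) k) (cong (suc x +_) (m∸n+n≡m k≤c))
      B+k≤y : B + k ≤ y
      B+k≤y = subst (_≤ y) (sym B+k≡1+x+c) (≰⇒> y≰x+c)
      a+y≤n : a + y ≤ n
      a+y≤n = ≤-trans (+-monoʳ-≤ a (<⇒≤ y<s)) a+s≤n
      viaFree : (∃ λ t → t < k × S (a + B + t) ≡ false) → W (a + x) (a + y)
      viaFree (t , t<k , Sy′) =
        arc (<-trans x<y y<s) y′<s (circulant-forward x<y′ y′≤x+c) (subst (λ z → S z ≡ false) (+-assoc a B t) Sy′)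
        ++ᵂ climb m (≤-trans y≤x+m (≤-trans (≤-reflexive (+-suc x m)) (+-monoˡ-≤ m x<y′)))
                    (≤-<-trans y′≤x+c (≰⇒> y≰x+c)) y<s Sy
        where
        y′ = B + t
        y′<B+k : y′ < B + k
        y′<B+k = +-monoʳ-< B t<k
        y′≤x+c : y′ ≤ x + c
        y′≤x+c = ≤-pred (subst (y′ <_) B+k≡1+x+c y′<B+k)
        x<y′ : x < y′
        x<y′ = s≤s (≤-trans (m≤m+n x (c ∸ k)) (m≤m+n (x + (c ∸ k)) t))
        y′<s : y′ < s
        y′<s = <-≤-trans y′<B+k (≤-trans B+k≤y (<⇒≤ y<s))

    climbPast : ∀ {x z} → x < s → z < s → S (a + z) ≡ false →
      ∃ λ v → z ≤ v × v < s × W (a + x) (a + v)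
    climbPast {x} {z} x<s z<s Sz with z ≤? x
    ... | yes z≤x = x , z≤x , x<s , here
    ... | no z≰x = z , ≤-refl , z<s , climb z (m≤n+m z x) (≰⇒> z≰x) z<s Sz

    descend : ∀ {v t y} → v < s → t < s → y < s → t + c < v → S (a + t) ≡ false → S (a + y) ≡ false →
      W (a + v) (a + y)
    descend {v} {t} {y} v<s t<s y<s t+c<v St Sy with y <? t
    ... | yes y<t = arc v<s y<s (circulant-backward {c} (<-trans (+-monoˡ-< c y<t) t+c<v)) Sy
    ... | no y≮t = arc v<s t<s (circulant-backward {c} t+c<v) St ++ᵂ fromT
      where
      fromT : W (a + t) (a + y)
      fromT with t <? y
      ... | yes t<y = climb y (m≤n+m y t) t<y y<s Sy
      ... | no t≮y = subst (λ w → W (a + t) (a + w)) (≤-antisym (≮⇒≥ y≮t) (≮⇒≥ t≮y)) here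

    -- Climb past z = s - k + t, then the backward arc to t; both survive by the choice of t.
    connected : ∀ {x y} → x < s → y < s → S (a + y) ≡ false → W (a + x) (a + y)
    connected {x} {y} x<s y<s Sy = viaPair (freePair a (a + (s ∸ k)) (+-monoʳ-≤ a k≤s∸k)
      (≤-trans (≤-reflexive (trans (+-assoc a (s ∸ k) k) (cong (a +_) s∸k+k≡s))) a+s≤n))
      where
      k+k<s : k + k < s
      k+k<s = <-≤-trans (s≤s (+-mono-≤ k≤c k≤c)) 2c<s
      k≤s : k ≤ s
      k≤s = ≤-trans (m≤m+n k k) (<⇒≤ k+k<s)
      s∸k+k≡s : s ∸ k + k ≡ s
      s∸k+k≡s = m∸n+n≡m k≤s
      k≤s∸k : k ≤ s ∸ k
      k≤s∸k = +-cancelʳ-≤ k k (s ∸ k) (subst (k + k ≤_) (sym s∸k+k≡s) (<⇒≤ k+k<s))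
      c<s∸k : c < s ∸ k
      c<s∸k = +-cancelʳ-< k c (s ∸ k)
        (subst (c + k <_) (sym s∸k+k≡s) (<-≤-trans (s≤s (+-monoʳ-≤ c k≤c)) 2c<s))
      viaPair : (∃ λ t → t < k × S (a + t) ≡ false × S (a + (s ∸ k) + t) ≡ false) → W (a + x) (a + y)
      viaPair (t , t<k , St , Sz) =
        close (climbPast x<s z<s (subst (λ w → S w ≡ false) (+-assoc a (s ∸ k) t) Sz))
        where
        z = s ∸ k + t
        z<s : z < s
        z<s = subst (z <_) s∸k+k≡s (+-monoʳ-< (s ∸ k) t<k)
        t+c<z : t + c < z
        t+c<z = subst (t + c <_) (+-comm t (s ∸ k)) (+-monoʳ-< t c<s∸k)
        close : (∃ λ v → z ≤ v × v < s × W (a + x) (a + v)) → W (a + x) (a + y)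
        close (v , z≤v , v<s , x⇝v) =
          x⇝v ++ᵂ descend v<s (<-≤-trans t<k k≤s) y<s (<-≤-trans t+c<z z≤v) St Sy

-- The construction

module Construction (n r k c : ℕ) (middleArcs : Bool) where

  q o : ℕ
  q = suc (c + c)
  o = q + r

  matched : ℕ → ℕ → Bool
  matched i j = does (j <? k) ∧ does (i ≟ o + j)

  data Part : Set where
    A M B : Part

  part : ℕ → Part
  part i = if does (i <? q) then A else if does (i <? o) then M else B

  arcs : Part → Part → ℕ → ℕ → Bool
  arcs A A i j = circulant c i j
  arcs A M _ _ = true
  arcs A B i j = not (matched j i)
  arcs M A _ _ = false
  arcs M M i j = middleArcs ∧ does (i <? j)
  arcs M B _ _ = true
  arcs B A i j = matched i j
  arcs B M _ _ = false
  arcs B B i j = circulant c (i ∸ o) (j ∸ o)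

  g : ℕ → ℕ → Bool
  g i j = arcs (part i) (part j) i j

  G : Digraph n
  G u v = g (toℕ u) (toℕ v)

  InM : ℕ → Set
  InM i = q ≤ i × i < o

  inM? : ∀ i → Dec (InM i)
  inM? i = q ≤? i ×-dec i <? o

  data Block (i : ℕ) : Set where
    inA : i < q → Block i
    inM : InM i → Block i
    inB : o ≤ i → Block i

  block : ∀ i → Block i
  block i with i <? q | i <? o
  ... | yes i<q | _ = inA i<q
  ... | no i≮q | yes i<o = inM (≮⇒≥ i≮q , i<o)
  ... | no _ | no i≮o = inB (≮⇒≥ i≮o)

  part-A : ∀ {i} → i < q → part i ≡ A
  part-A {i} i<q rewrite dec-true (i <? q) i<q = refl

  part-M : ∀ {i} → InM i → part i ≡ M
  part-M {i} (q≤i , i<o) rewrite dec-false (i <? q) (≤⇒≯ q≤i) | dec-true (i <? o) i<o = refl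

  part-B : ∀ {i} → o ≤ i → part i ≡ B
  part-B {i} o≤i rewrite dec-false (i <? q) (λ i<q → <⇒≱ i<q (≤-trans (m≤m+n q r) o≤i))
                       | dec-false (i <? o) (≤⇒≯ o≤i) = refl

  g-parts : ∀ {i j x y} → part i ≡ x → part j ≡ y → g i j ≡ arcs x y i j
  g-parts {i} {j} = cong₂ (λ x y → arcs x y i j)

  g-AA : ∀ {i j} → i < q → j < q → g i j ≡ circulant c i j
  g-AA {i} {j} i<q j<q = g-parts {i} {j} (part-A i<q) (part-A j<q)

  g-AM : ∀ {i j} → i < q → InM j → g i j ≡ true
  g-AM {i} {j} i<q j∈M = g-parts {i} {j} (part-A i<q) (part-M j∈M)

  g-AB : ∀ {i j} → i < q → o ≤ j → g i j ≡ not (matched j i)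
  g-AB {i} {j} i<q o≤j = g-parts {i} {j} (part-A i<q) (part-B o≤j)

  g-MA : ∀ {i j} → InM i → j < q → g i j ≡ false
  g-MA {i} {j} i∈M j<q = g-parts {i} {j} (part-M i∈M) (part-A j<q)

  g-MM : ∀ {i j} → InM i → InM j → g i j ≡ middleArcs ∧ does (i <? j)
  g-MM {i} {j} i∈M j∈M = g-parts {i} {j} (part-M i∈M) (part-M j∈M)

  g-MB : ∀ {i j} → InM i → o ≤ j → g i j ≡ true
  g-MB {i} {j} i∈M o≤j = g-parts {i} {j} (part-M i∈M) (part-B o≤j)

  g-BA : ∀ {i j} → o ≤ i → j < q → g i j ≡ matched i j
  g-BA {i} {j} o≤i j<q = g-parts {i} {j} (part-B o≤i) (part-A j<q)

  g-BM : ∀ {i j} → o ≤ i → InM j → g i j ≡ false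
  g-BM {i} {j} o≤i j∈M = g-parts {i} {j} (part-B o≤i) (part-M j∈M)

  g-BB : ∀ {i j} → o ≤ i → o ≤ j → g i j ≡ circulant c (i ∸ o) (j ∸ o)
  g-BB {i} {j} o≤i o≤j = g-parts {i} {j} (part-B o≤i) (part-B o≤j)

  g-irrefl : ∀ i → g i i ≡ false
  g-irrefl i with block i
  ... | inA i<q = trans (g-AA i<q i<q) (circulant-irrefl c i)
  ... | inM i∈M = trans (g-MM i∈M i∈M)
    (trans (cong (middleArcs ∧_) (dec-false (i <? i) (<-irrefl refl))) (Bool.∧-zeroʳ middleArcs))
  ... | inB o≤i = trans (g-BB o≤i o≤i) (circulant-irrefl c (i ∸ o))

  g-flip-by : ∀ {i j x y} → g j i ≡ x → g i j ≡ y → x ≡ not y → g j i ≡ not (g i j)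
  g-flip-by ji ij x≡¬y = trans ji (trans x≡¬y (cong not (sym ij)))

  g-flip : ∀ {i j} → i ≢ j → ¬ (InM i × InM j) → g j i ≡ not (g i j)
  g-flip {i} {j} i≢j notBoth with block i | block j
  ... | inA i<q | inA j<q = g-flip-by {i} {j} (g-AA j<q i<q) (g-AA i<q j<q) (circulant-flip i≢j)
  ... | inA i<q | inM j∈M = g-flip-by {i} {j} (g-MA j∈M i<q) (g-AM i<q j∈M) refl
  ... | inA i<q | inB o≤j = g-flip-by {i} {j} (g-BA o≤j i<q) (g-AB i<q o≤j) (sym (Bool.not-involutive _))
  ... | inM i∈M | inA j<q = g-flip-by {i} {j} (g-AM j<q i∈M) (g-MA i∈M j<q) refl
  ... | inM i∈M | inM j∈M = contradiction (i∈M , j∈M) notBoth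
  ... | inM i∈M | inB o≤j = g-flip-by {i} {j} (g-BM o≤j i∈M) (g-MB i∈M o≤j) refl
  ... | inB o≤i | inA j<q = g-flip-by {i} {j} (g-AB j<q o≤i) (g-BA o≤i j<q) refl
  ... | inB o≤i | inM j∈M = g-flip-by {i} {j} (g-MB j∈M o≤i) (g-BM o≤i j∈M) refl
  ... | inB o≤i | inB o≤j =
    g-flip-by {i} {j} (g-BB o≤j o≤i) (g-BB o≤i o≤j) (circulant-flip (i≢j ∘ ∸-cancelʳ-≡ o≤i o≤j))

  g-antisym : ∀ i j → g i j ≡ true → g j i ≡ false
  g-antisym i j i→j with i ≟ j
  ... | yes refl = contradiction (trans (sym i→j) (g-irrefl i)) λ ()
  ... | no i≢j with inM? i ×-dec inM? j
  ...   | no notBoth = trans (g-flip i≢j notBoth) (cong not i→j)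
  ...   | yes (i∈M , j∈M) = trans (g-MM j∈M i∈M)
    (trans (cong (middleArcs ∧_) (dec-false (j <? i) (<⇒≯ i<j))) (Bool.∧-zeroʳ middleArcs))
    where
    i<j : i < j
    i<j = does⇒ (i <? j) (∧-trueʳ (trans (sym (g-MM i∈M j∈M)) i→j))

  g-total : ∀ i j → i ≢ j → g i j ≡ true ⊎ g j i ≡ true ⊎ (InM i × InM j × middleArcs ≡ false)
  g-total i j i≢j with inM? i ×-dec inM? j
  ... | no notBoth with g i j in i→j
  ...   | true = inj₁ refl
  ...   | false = inj₂ (inj₁ (trans (g-flip i≢j notBoth) (cong not i→j)))
  g-total i j i≢j | yes (i∈M , j∈M) with middleArcs Bool.≟ true
  ...   | no noArcs = inj₂ (inj₂ (i∈M , j∈M , ¬-not noArcs))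
  ...   | yes arcs with <-cmp i j
  ...     | tri< i<j _ _ = inj₁ (trans (g-MM i∈M j∈M) (∧-true arcs (dec-true (i <? j) i<j)))
  ...     | tri≈ _ i≡j _ = contradiction i≡j i≢j
  ...     | tri> _ _ j<i = inj₂ (inj₁ (trans (g-MM j∈M i∈M) (∧-true arcs (dec-true (j <? i) j<i))))

  oriented : Oriented G
  oriented = (λ v → g-irrefl (toℕ v)) , (λ u v → g-antisym (toℕ u) (toℕ v))

  tournament : middleArcs ≡ true → Tournament G
  tournament arcs = oriented , λ u v u≢v → adjacent (g-total (toℕ u) (toℕ v) (u≢v ∘ toℕ-injective))
    where
    adjacent : ∀ {x y} {P Q : Set} → x ≡ true ⊎ y ≡ true ⊎ (P × Q × middleArcs ≡ false) →
      x ≡ true ⊎ y ≡ true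
    adjacent (inj₁ x) = inj₁ x
    adjacent (inj₂ (inj₁ y)) = inj₂ y
    adjacent (inj₂ (inj₂ (_ , _ , noArcs))) = contradiction (trans (sym arcs) noArcs) λ ()

  g-B-offset : ∀ x y → g (o + x) (o + y) ≡ circulant c x y
  g-B-offset x y = trans (g-BB (m≤m+n o x) (m≤m+n o y)) (cong₂ (circulant c) (m+n∸m≡n o x) (m+n∸m≡n o y))

  module _ (fits : o + q ≤ n) where

    q≤n : q ≤ n
    q≤n = ≤-trans (m≤n+m q o) fits

    o≤n : o ≤ n
    o≤n = ≤-trans (m≤m+n o q) fits

    p : ℕ
    p = n ∸ o

    o+p≡n : o + p ≡ n
    o+p≡n = m+[n∸m]≡n o≤n

    q≤p : q ≤ p
    q≤p = subst (_≤ p) (m+n∸m≡n o q) (∸-monoˡ-≤ o fits)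

    c<q : c < q
    c<q = s≤s (m≤m+n c c)

    outdeg-≥ : ∀ i → i < n → c ≤ countTo n (g i)
    outdeg-≥ i i<n with block i
    ... | inA i<q = circulant-outdegree {a = 0} (g i) q≤n ≤-refl i<q
      (λ y y<q i→y → trans (g-AA i<q y<q) i→y)
    ... | inM i∈M = countTo-interval {o} {c} (g i) (≤-trans (+-monoʳ-≤ o (<⇒≤ c<q)) fits)
      (λ t _ → g-MB i∈M (m≤m+n o t))
    ... | inB o≤i = circulant-outdegree {a = o} (g i) (≤-reflexive o+p≡n) q≤p (∸-monoˡ-< i<n o≤i)
      (λ y _ i→y → subst (λ z → g z (o + y) ≡ true) (m+[n∸m]≡n o≤i) (trans (g-B-offset (i ∸ o) y) i→y))

    indeg-≥ : ∀ i → i < n → c ≤ countTo n (λ j → g j i)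
    indeg-≥ i i<n with block i
    ... | inA i<q = circulant-indegree {a = 0} (λ j → g j i) q≤n ≤-refl i<q
      (λ y y<q y→i → trans (g-AA y<q i<q) y→i)
    ... | inM i∈M = countTo-interval {0} {c} (λ j → g j i) (≤-trans (<⇒≤ c<q) q≤n)
      (λ t t<c → g-AM (<-trans t<c c<q) i∈M)
    ... | inB o≤i = circulant-indegree {a = o} (λ j → g j i) (≤-reflexive o+p≡n) q≤p (∸-monoˡ-< i<n o≤i)
      (λ y _ y→i → subst (λ z → g (o + y) z ≡ true) (m+[n∸m]≡n o≤i) (trans (g-B-offset y (i ∸ o)) y→i))

    minDegs : MinDegsAtLeast G c
    minDegs = (λ v → outdeg-≥ (toℕ v) (toℕ<n v)) , (λ v → indeg-≥ (toℕ v) (toℕ<n v))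

    middle : Fin n → Bool
    middle u = does (inM? (toℕ u))

    matching-≤ : pairs {n} (λ u v → matched (toℕ u) (toℕ v)) ≤ k
    matching-≤ = begin
      pairs {n} (λ u v → matched (toℕ u) (toℕ v))
        ≡⟨ pairs-transpose {n} (λ u v → matched (toℕ u) (toℕ v)) ⟩
      sumFin {n} (λ v → countTo n (λ i → matched i (toℕ v)))
        ≤⟨ sumFin-mono {n} (λ v → count-guard {n} (does (toℕ v <? k)) (λ i → does (toℕ i ≟ o + toℕ v))
                                               (λ _ → column (toℕ v))) ⟩
      sumFin {n} (λ v → bit (does (toℕ v <? k)) * 1)
        ≡⟨ sumFin-*ʳ {n} (λ v → bit (does (toℕ v <? k))) 1 ⟩
      sumFin {n} (λ v → bit (does (toℕ v <? k))) * 1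
        ≡⟨ cong (_* 1) (count≡sumFin-bit {n} (λ v → does (toℕ v <? k))) ⟨
      countTo n (λ j → does (j <? k)) * 1
        ≤⟨ *-monoˡ-≤ 1 (countTo-support {0} {k} n _ (λ j j<k → z≤n , does⇒ (j <? k) j<k)) ⟩
      k * 1
        ≡⟨ *-identityʳ k ⟩
      k ∎
      where
      open ≤-Reasoning
      column : ∀ j → countTo n (λ i → does (i ≟ o + j)) ≤ 1
      column j = countTo-support {o + j} {1} n _ λ i i≡o+j → let e = does⇒ (i ≟ o + j) i≡o+j in
        ≤-reflexive (sym e) , ≤-<-trans (≤-reflexive e) (m<m+n (o + j) (s≤s z≤n))

    crossingArc : ∀ {i j} → q ≤ i → j < o → g i j ≡ true →
      matched i j ∨ (does (inM? i) ∧ does (inM? j) ∧ g i j) ≡ true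
    crossingArc {i} {j} q≤i j<o i→j with block i | block j
    ... | inA i<q | _ = contradiction q≤i (<⇒≱ i<q)
    ... | inM i∈M | inA j<q = contradiction (trans (sym (g-MA i∈M j<q)) i→j) λ ()
    ... | inM i∈M | inM j∈M = ∨-introʳ (∧-true (dec-true (inM? i) i∈M) (∧-true (dec-true (inM? j) j∈M) i→j))
    ... | inM _ | inB o≤j = contradiction j<o (≤⇒≯ o≤j)
    ... | inB o≤i | inA j<q = ∨-introˡ (trans (sym (g-BA o≤i j<q)) i→j)
    ... | inB o≤i | inM j∈M = contradiction (trans (sym (g-BM o≤i j∈M)) i→j) λ ()
    ... | inB _ | inB o≤j = contradiction j<o (≤⇒≯ o≤j)

    edgeCount-bound : ∀ {D} → Spanning D G → MinDegsAtLeast D k →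
      (n + r) * k ≤ edgeCount D + (k + arcsWithin middle G)
    edgeCount-bound {D} D⊆G δD = begin
      (n + r) * k                                     ≡⟨ cong (_* k) n+r≡[n∸q]+o ⟩
      (n ∸ q + o) * k                                 ≡⟨ *-distribʳ-+ k (n ∸ q) o ⟩
      (n ∸ q) * k + o * k
        ≤⟨ +-mono-≤ (*-monoˡ-≤ k outsideA-size) (*-monoˡ-≤ k outsideB-size) ⟩
      count outsideA * k + count outsideB * k         ≤⟨ edgeCount-≥ outsideA outsideB D⊆G δD ⟩
      edgeCount D + pairs (λ u v → outsideA u ∧ outsideB v ∧ G u v)
        ≤⟨ +-monoʳ-≤ (edgeCount D) (≤-trans (pairs-mono {n} crossing)
             (≤-trans (pairs-∨ (λ u v → matched (toℕ u) (toℕ v)) (λ u v → middle u ∧ middle v ∧ G u v))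
                      (+-monoˡ-≤ _ matching-≤))) ⟩
      edgeCount D + (k + arcsWithin middle G)         ∎
      where
      open ≤-Reasoning
      outsideA outsideB : Fin n → Bool
      outsideA u = does (q ≤? toℕ u)
      outsideB v = does (toℕ v <? o)
      outsideA-size : n ∸ q ≤ count outsideA
      outsideA-size = countTo-interval {q} {n ∸ q} (λ i → does (q ≤? i)) (≤-reflexive (m+[n∸m]≡n q≤n))
        (λ t _ → dec-true (q ≤? q + t) (m≤m+n q t))
      outsideB-size : o ≤ count outsideB
      outsideB-size = countTo-interval {0} {o} (λ i → does (i <? o)) o≤n (λ t t<o → dec-true (t <? o) t<o)
      crossing : ∀ u v → outsideA u ∧ outsideB v ∧ G u v ≡ true →
        matched (toℕ u) (toℕ v) ∨ (middle u ∧ middle v ∧ G u v) ≡ true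
      crossing u v arc = crossingArc (does⇒ (q ≤? toℕ u) (∧-trueˡ arc))
        (does⇒ (toℕ v <? o) (∧-trueˡ (∧-trueʳ {outsideA u} arc))) (∧-trueʳ (∧-trueʳ {outsideA u} arc))
      n+r≡[n∸q]+o : n + r ≡ n ∸ q + o
      n+r≡[n∸q]+o = trans (cong (_+ r) (sym (m∸n+n≡m q≤n))) (+-assoc (n ∸ q) q r)

    middle-size : count middle ≤ r
    middle-size = countTo-support {q} {r} n (λ i → does (inM? i)) (λ i → does⇒ (inM? i))

    arcsWithin-middle-none : middleArcs ≡ false → arcsWithin middle G ≡ 0
    arcsWithin-middle-none noArcs = ≤-antisym (≤-trans (pairs-mono {n} noArc) (≤-reflexive (pairs-none n))) z≤n
      where
      noArc : ∀ u v → middle u ∧ middle v ∧ G u v ≡ true → false ≡ true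
      noArc u v arc = trans (sym (cong (_∧ _) noArcs))
        (trans (sym (g-MM (does⇒ (inM? (toℕ u)) (∧-trueˡ arc))
                          (does⇒ (inM? (toℕ v)) (∧-trueˡ (∧-trueʳ {middle u} arc)))))
               (∧-trueʳ (∧-trueʳ {middle u} arc)))

    arcsWithin-middle-≤ : arcsWithin middle G + arcsWithin middle G ≤ r * (r ∸ 1)
    arcsWithin-middle-≤ =
      ≤-trans (arcsWithin-≤ middle oriented) (*-mono-≤ middle-size (∸-monoˡ-≤ 1 middle-size))

    nonNeighbours-≤ : ∀ v → nonNeighbours G v ≤ r ∸ 1
    nonNeighbours-≤ v = begin
      nonNeighbours G v
        ≤⟨ count-mono inMiddle ⟩
      count (λ w → middle v ∧ (middle w ∧ not ⌊ v Fin.≟ w ⌋))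
        ≤⟨ count-guard (middle v) (λ w → middle w ∧ not ⌊ v Fin.≟ w ⌋) (count-others middle {v}) ⟩
      bit (middle v) * (count middle ∸ 1)
        ≤⟨ bit-*-≤ (middle v) ⟩
      count middle ∸ 1
        ≤⟨ ∸-monoˡ-≤ 1 middle-size ⟩
      r ∸ 1 ∎
      where
      open ≤-Reasoning
      inMiddle : ∀ w → not ⌊ v Fin.≟ w ⌋ ∧ not (G v w) ∧ not (G w v) ≡ true →
        middle v ∧ (middle w ∧ not ⌊ v Fin.≟ w ⌋) ≡ true
      inMiddle w nonAdj = fromTotal (g-total (toℕ v) (toℕ w) (v≢w ∘ toℕ-injective))
        where
        v≢w : v ≢ w
        v≢w = ⌊⌋-false⇒ (v Fin.≟ w) (not-true (∧-trueˡ nonAdj))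
        ¬v→w : G v w ≡ false
        ¬v→w = not-true (∧-trueˡ (∧-trueʳ {not ⌊ v Fin.≟ w ⌋} nonAdj))
        ¬w→v : G w v ≡ false
        ¬w→v = not-true (∧-trueʳ {not (G v w)} (∧-trueʳ {not ⌊ v Fin.≟ w ⌋} nonAdj))
        fromTotal : G v w ≡ true ⊎ G w v ≡ true ⊎ (InM (toℕ v) × InM (toℕ w) × middleArcs ≡ false) →
          middle v ∧ (middle w ∧ not ⌊ v Fin.≟ w ⌋) ≡ true
        fromTotal (inj₁ v→w) = contradiction (trans (sym v→w) ¬v→w) λ ()
        fromTotal (inj₂ (inj₁ w→v)) = contradiction (trans (sym w→v) ¬w→v) λ ()
        fromTotal (inj₂ (inj₂ (v∈M , w∈M , _))) =
          ∧-true (dec-true (inM? (toℕ v)) v∈M) (∧-true (dec-true (inM? (toℕ w)) w∈M) (∧-trueˡ nonAdj))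

    matched-far : ∀ {w i} → k ≤ w → matched (o + w) i ≡ false
    matched-far {w} {i} k≤w = ¬-not λ m → <⇒≱ (does⇒ (i <? k) (∧-trueˡ m))
      (≤-trans k≤w (≤-reflexive (+-cancelˡ-≡ o w i (does⇒ (o + w ≟ o + i) (∧-trueʳ {does (i <? k)} m)))))

    module Connectivity (k≤c : k ≤ c) (S : ℕ → Bool) (few : countTo n S < k) where
      open AvoidingFew {n} S few

      module InA = CirculantInterval g k≤c 0 q q≤n ≤-refl (λ x<q y<q → trans (g-AA x<q y<q))
      module InB = CirculantInterval g k≤c o p (≤-reflexive o+p≡n) q≤p (λ {x} {y} _ _ → trans (g-B-offset x y))

      k<q : k < q
      k<q = ≤-<-trans k≤c c<q

      k+k≤q : k + k ≤ q
      k+k≤q = ≤-trans (+-mono-≤ k≤c k≤c) (n≤1+n (c + c))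

      -- Every walk passes through the matching arc o + t → t, and enters B at o + w, which every
      -- vertex of A ∪ M dominates because w ≥ k is not matched.
      module ViaHub {t w} (t<k : t < k) (St : S t ≡ false) (So+t : S (o + t) ≡ false)
                    (k≤w : k ≤ w) (w<p : w < p) (So+w : S (o + w) ≡ false) where

        t<q : t < q
        t<q = <-trans t<k k<q

        o+w<n : o + w < n
        o+w<n = subst (o + w <_) o+p≡n (+-monoʳ-< o w<p)

        A→o+w : ∀ {i} → i < q → g i (o + w) ≡ true
        A→o+w i<q = trans (g-AB i<q (m≤m+n o w)) (cong not (matched-far k≤w))

        o+w⇝o+t : Walk n g S (o + w) (o + t)
        o+w⇝o+t = InB.connected w<p (<-≤-trans t<q q≤p) So+t

        toHub : ∀ i → i < n → Walk n g S i (o + t)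
        toHub i i<n with block i
        ... | inA i<q = step o+w<n (A→o+w i<q) So+w o+w⇝o+t
        ... | inM i∈M = step o+w<n (g-MB i∈M (m≤m+n o w)) So+w o+w⇝o+t
        ... | inB o≤i = subst (λ z → Walk n g S z (o + t)) (m+[n∸m]≡n o≤i)
          (InB.connected (∸-monoˡ-< i<n o≤i) (<-≤-trans t<q q≤p) So+t)

        fromHub : ∀ l → l < n → S l ≡ false → Walk n g S t l
        fromHub l l<n Sl with block l
        ... | inA l<q = InA.connected t<q l<q Sl
        ... | inM l∈M = step l<n (g-AM t<q l∈M) Sl here
        ... | inB o≤l with l ≟ o + t
        ...   | yes refl = step o+w<n (A→o+w t<q) So+w o+w⇝o+t
        ...   | no l≢o+t = step l<n (trans (g-AB t<q o≤l) (cong not unmatched)) Sl here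
          where
          unmatched : matched l t ≡ false
          unmatched = ¬-not (l≢o+t ∘ does⇒ (l ≟ o + t) ∘ ∧-trueʳ {does (t <? k)})

        matchingArc : g (o + t) t ≡ true
        matchingArc = trans (g-BA (m≤m+n o t) t<q) (∧-true (dec-true (t <? k) t<k) (dec-true (o + t ≟ o + t) refl))

        connected : ∀ i l → i < n → l < n → S l ≡ false → Walk n g S i l
        connected i l i<n l<n Sl =
          toHub i i<n ++ᵂ step (<-≤-trans t<q q≤n) matchingArc St (fromHub l l<n Sl)

      connected : ∀ i l → i < n → l < n → S l ≡ false → Walk n g S i l
      connected with freePair 0 o (≤-trans (<⇒≤ k<q) (m≤m+n q r)) (≤-trans (+-monoʳ-≤ o (<⇒≤ k<q)) fits)
                   | free (o + k) (≤-trans (≤-reflexive (+-assoc o k k)) (≤-trans (+-monoʳ-≤ o k+k≤q) fits))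
      ... | t , t<k , St , So+t | e , e<k , So+k+e = ViaHub.connected t<k St So+t (m≤m+n k e)
        (<-≤-trans (+-monoʳ-< k e<k) (≤-trans k+k≤q q≤p)) (subst (λ z → S z ≡ false) (+-assoc o k e) So+k+e)

    stronglyConnected : 1 ≤ k → k ≤ c → StronglyKConnected k G
    stronglyConnected 1≤k k≤c = k+1≤n , λ S small u v _ Sv →
      walk⇒reach S (Connectivity.connected k≤c (extend S) (few S small) (toℕ u) (toℕ v) (toℕ<n u) (toℕ<n v)
        (trans (extend-toℕ S v) Sv)) u v refl refl
      where
      k+1≤n : k + 1 ≤ n
      k+1≤n = subst (_≤ n) (+-comm 1 k) (≤-trans (s≤s k≤c) (≤-trans c<q q≤n))
      few : ∀ S → count S ≤ k ∸ 1 → countTo n (extend S) < k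
      few S small = ≤-<-trans (count-mono (λ i → trans (sym (extend-toℕ S i))))
                              (≤-<-trans small (∸-monoʳ-< {k} {1} {0} (s≤s z≤n) 1≤k))

-- Choice of parameters

blocks-fit : ∀ k r n → 4 * k + (r + 2) ≤ n →
  let c = (n ∸ (r + 2)) / 4 in k ≤ c × suc (c + c) + r + suc (c + c) ≤ n
blocks-fit k r n size = k≤c , fits
  where
  c = (n ∸ (r + 2)) / 4
  r+2≤n : r + 2 ≤ n
  r+2≤n = ≤-trans (m≤n+m (r + 2) (4 * k)) size
  x+[r+2]≡n : n ∸ (r + 2) + (r + 2) ≡ n
  x+[r+2]≡n = m∸n+n≡m r+2≤n
  k≤c : k ≤ c
  k≤c = subst (_≤ c) (m*n/n≡m k 4) (/-monoˡ-≤ 4 (subst (_≤ n ∸ (r + 2)) (*-comm 4 k)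
          (+-cancelʳ-≤ (r + 2) (4 * k) _ (subst (4 * k + (r + 2) ≤_) (sym x+[r+2]≡n) size))))
  blocks : ∀ c r → suc (c + c) + r + suc (c + c) ≡ c * 4 + (r + 2)
  blocks = solve-∀
  fits : suc (c + c) + r + suc (c + c) ≤ n
  fits = subst₂ _≤_ (sym (blocks c r)) x+[r+2]≡n (+-monoˡ-≤ (r + 2) (m/n*n≤m (n ∸ (r + 2)) 4))

m/4∸1≤[m∸3]/4 : ∀ m → m / 4 ∸ 1 ≤ (m ∸ 3) / 4
m/4∸1≤[m∸3]/4 m = subst (m / 4 ∸ 1 ≤_) (m+n∸n≡m ((m ∸ 3) / 4) 1) (∸-monoˡ-≤ 1 (begin
  m / 4                 ≤⟨ /-monoˡ-≤ 4 (≤-trans (m≤n+m∸n m 3) (n≤1+n _)) ⟩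
  (4 + (m ∸ 3)) / 4     ≡⟨ m/n≡1+[m∸n]/n {4 + (m ∸ 3)} {4} (m≤m+n 4 (m ∸ 3)) ⟩
  suc ((m ∸ 3) / 4)     ≡⟨ +-comm 1 _ ⟩
  (m ∸ 3) / 4 + 1       ∎))
  where open ≤-Reasoning

cancel-degree-sum : ∀ k n d e → (n + suc d) * k ≤ e + (k + 0) → k * n + k * d ≤ e
cancel-degree-sum k n d e bound = +-cancelʳ-≤ k _ _ (subst₂ _≤_ (lhs k n d) (rhs e k) bound)
  where
  lhs : ∀ k n d → (n + suc d) * k ≡ k * n + k * d + k
  lhs = solve-∀
  rhs : ∀ e k → e + (k + 0) ≡ e + k
  rhs = solve-∀

cancel-degree-sum-halved : ∀ k′ n e X → (n + suc k′) * suc k′ ≤ e + (suc k′ + X) → X + X ≤ suc k′ * k′ →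
  suc k′ * n + suc k′ * k′ / 2 ≤ e
cancel-degree-sum-halved k′ n e X bound X+X≤M = +-cancelʳ-≤ H _ _ (begin
  suc k′ * n + H + H      ≡⟨ +-assoc (suc k′ * n) H H ⟩
  suc k′ * n + (H + H)    ≤⟨ +-monoʳ-≤ (suc k′ * n) (subst (_≤ M) (sym (double H)) (m/n*n≤m M 2)) ⟩
  suc k′ * n + M          ≤⟨ +-cancelʳ-≤ (suc k′) _ _ (subst₂ _≤_ (lhs k′ n) (rhs e k′ X) bound) ⟩
  e + X                   ≤⟨ +-monoʳ-≤ e X≤H ⟩
  e + H                   ∎)
  where
  open ≤-Reasoning
  M = suc k′ * k′
  H = M / 2
  lhs : ∀ k′ n → (n + suc k′) * suc k′ ≡ suc k′ * n + suc k′ * k′ + suc k′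
  lhs = solve-∀
  rhs : ∀ e k′ X → e + (suc k′ + X) ≡ e + X + suc k′
  rhs = solve-∀
  double : ∀ X → X + X ≡ X * 2
  double = solve-∀
  X≤H : X ≤ H
  X≤H = subst (_≤ H) (m*n/n≡m X 2) (/-monoˡ-≤ 2 (subst (_≤ M) (double X) X+X≤M))

minDegs-mono : ∀ {n} {D : Digraph n} {a b} → a ≤ b → MinDegsAtLeast D b → MinDegsAtLeast D a
minDegs-mono a≤b (δ⁺ , δ⁻) = (λ v → ≤-trans a≤b (δ⁺ v)) , (λ v → ≤-trans a≤b (δ⁻ v))

orientedGraph : ∀ k d → 1 ≤ k → (n : ℕ) → 4 * k + d + 3 ≤ n →
  Σ (Digraph n) (λ G → Oriented G × StronglyKConnected k G
    × MaxNonDegAtMost G d × MinDegsAtLeast G ((n ∸ d) / 4 ∸ 1)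
    × ((D : Digraph n) → Spanning D G → MinDegsAtLeast D k → k * n + k * d ≤ edgeCount D))
orientedGraph k d 1≤k n size =
  G , oriented , stronglyConnected fits 1≤k k≤c , nonNeighbours-≤ fits , minDegs-mono degree (minDegs fits) ,
  λ D D⊆G δD → cancel-degree-sum k n d (edgeCount D)
    (subst (λ X → (n + suc d) * k ≤ edgeCount D + (k + X)) (arcsWithin-middle-none fits refl)
           (edgeCount-bound fits D⊆G δD))
  where
  c = (n ∸ (suc d + 2)) / 4
  open Construction n (suc d) k c false
  size′ : 4 * k + (suc d + 2) ≤ n
  size′ = subst (_≤ n) (reassociate k d) size
    where
    reassociate : ∀ k d → 4 * k + d + 3 ≡ 4 * k + (suc d + 2)
    reassociate = solve-∀
  k≤c = proj₁ (blocks-fit k (suc d) n size′)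
  fits = proj₂ (blocks-fit k (suc d) n size′)
  degree : (n ∸ d) / 4 ∸ 1 ≤ c
  degree = subst (λ m → (n ∸ d) / 4 ∸ 1 ≤ m / 4) (trans (∸-+-assoc n d 3) (cong (n ∸_) (+-suc d 2)))
    (m/4∸1≤[m∸3]/4 (n ∸ d))

tournament : ∀ k → 1 ≤ k → (n : ℕ) → 5 * k + 2 ≤ n →
  Σ (Digraph n) (λ T → Tournament T × StronglyKConnected k T
    × MinDegsAtLeast T ((n ∸ k ∸ 3) / 4)
    × ((D : Digraph n) → Spanning D T → MinDegsAtLeast D k → k * n + (k * (k ∸ 1)) / 2 ≤ edgeCount D))
tournament (suc k′) 1≤k n size =
  G , Construction.tournament n k k c true refl , stronglyConnected fits 1≤k k≤c , minDegs-mono degree (minDegs fits) ,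
  λ D D⊆G δD →
    cancel-degree-sum-halved k′ n (edgeCount D) _ (edgeCount-bound fits D⊆G δD) (arcsWithin-middle-≤ fits)
  where
  k = suc k′
  c = (n ∸ (k + 2)) / 4
  open Construction n k k c true hiding (tournament)
  size′ : 4 * k + (k + 2) ≤ n
  size′ = subst (_≤ n) (split k) size
    where
    split : ∀ k → 5 * k + 2 ≡ 4 * k + (k + 2)
    split = solve-∀
  k≤c = proj₁ (blocks-fit k k n size′)
  fits = proj₂ (blocks-fit k k n size′)
  degree : (n ∸ k ∸ 3) / 4 ≤ c
  degree = /-monoˡ-≤ 4 (≤-trans (∸-monoʳ-≤ (n ∸ k) (n≤1+n 2)) (≤-reflexive (∸-+-assoc n k 2)))

proposition3p1 : (k d : ℕ) → 1 ≤ k →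
    ((n : ℕ) → 4 * k + d + 3 ≤ n →
      Σ (Digraph n) (λ G → Oriented G × StronglyKConnected k G
        × MaxNonDegAtMost G d × MinDegsAtLeast G ((n ∸ d) / 4 ∸ 1)
        × ((D : Digraph n) → Spanning D G → MinDegsAtLeast D k →
             k * n + k * d ≤ edgeCount D)))
    × ((n : ℕ) → 5 * k + 2 ≤ n →
      Σ (Digraph n) (λ T → Tournament T × StronglyKConnected k T
        × MinDegsAtLeast T ((n ∸ k ∸ 3) / 4)
        × ((D : Digraph n) → Spanning D T → MinDegsAtLeast D k →
             k * n + (k * (k ∸ 1)) / 2 ≤ edgeCount D)))
proposition3p1 k d 1≤k = orientedGraph k d 1≤k , tournament k 1≤k
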